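{- Let $\mathcal{A},\mathcal{B},\mathcal{C}$ be families of subsets of $[n]$ such that each of them consists of at least seven pairwise disjoint non-empty sets. Then there exist $A\in\mathcal{A}$, $B\in\mathcal{B}$, $C\in\mathcal{C}$ such that $A\setminus(B\cup C)$, $B\setminus(A\cup C)$ and $C\setminus(A\cup B)$ are each non-empty. -}

module Defs where

open import Data.Nat using (ℕ; _≤_)
open import Data.Product using (_×_)
open import Data.List using (List; length)
open import Data.List.Relation.Unary.All using (All)
open import Data.List.Relation.Unary.AllPairs using (AllPairs)
open import Data.Fin.Subset using (Subset; _∩_; Empty; Nonempty)

Disjoint : {n : ℕ} → Subset n → Subset n → Set
Disjoint p q = Empty (p ∩ q)

-- A family of subsets of [n], given as a list of its members, "consists of
-- at least seven pairwise disjoint non-empty sets": it has at least seven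
-- members, every member is non-empty, and distinct positions are disjoint.
-- (Pairwise disjointness of non-empty sets forces the list entries to be
-- distinct, so the list length is the size of the family.)
SevenDisjointFamily : {n : ℕ} → List (Subset n) → Set
SevenDisjointFamily F = (7 ≤ length F) × All Nonempty F × AllPairs Disjoint F

module Submission where

-- Proof by
-- double counting: fix a representative in every member, and say members of
-- two families conflict when the representative of one lies in the other.
-- A point lies in at most one member of a disjoint family, so between two
-- families there are at most 2m conflicts over all m² pairs.  A triple is
-- spoilt by a conflict of one of its three pairs, each conflicting pair
-- spoils m triples, so at most 3 · m · 2m = 6m² < m³ triples are spoilt and
-- in an unspoilt triple the representatives are private points.

open import Defs
open import Data.Nat using (ℕ; zero; suc; _+_; _*_; _≤_; _<_; z≤n; s≤s)
open import Data.Nat.Properties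
  using (_<?_; ≤-refl; ≤-reflexive; ≤-trans; ≤-<-trans; n<1+n; ≮⇒≥; n<1⇒n≡0;
         +-mono-≤; +-monoˡ-≤; +-cancelˡ-<; m+n≡0⇒m≡0; m+n≡0⇒n≡0; *-zeroʳ; *-identityʳ; *-monoˡ-≤; *-monoˡ-<;
         +-0-commutativeMonoid; module ≤-Reasoning)
open import Data.Nat.Tactic.RingSolver using (solve-∀)
open import Data.Product using (Σ; _×_; _,_; proj₁; proj₂; ∃-syntax)
open import Data.Sum using (inj₁; inj₂)
open import Data.List using (List; length; lookup)
open import Data.List.Membership.Propositional using (_∈_)
open import Data.List.Membership.Propositional.Properties using (∈-lookup)
open import Data.List.Relation.Unary.All as All using (All)
open import Data.List.Relation.Unary.AllPairs using (AllPairs; _∷_)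
open import Data.Fin using (Fin; zero; suc; inject≤)
open import Data.Fin.Properties using (suc-injective; inject≤-injective)
open import Data.Fin.Subset using (Subset; _∪_; _─_; Nonempty; inside; outside)
  renaming (_∈_ to _∈ₛ_; _∉_ to _∉ₛ_)
open import Data.Fin.Subset.Properties using (_∈?_; x∈p∩q⁺; x∈p∪q⁻)
open import Data.Vec using (_∷_)
open import Data.Vec.Base using (here; there)
open import Algebra.Properties.CommutativeMonoid.Sum +-0-commutativeMonoid
  using (sum; sum-syntax; ∑-comm; ∑-distrib-+; sum-cong-≗)
open import Relation.Nullary using (¬_; Dec; yes; no; contradiction)
open import Relation.Binary.PropositionalEquality
  using (_≡_; refl; sym; cong; subst; module ≡-Reasoning)
open import Function using (_∘_)

∑-bound : ∀ {m c} (f : Fin m → ℕ) → (∀ i → f i ≤ c) → ∑[ i < m ] f i ≤ m * c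
∑-bound {zero}  f f≤c = z≤n
∑-bound {suc m} f f≤c = +-mono-≤ (f≤c zero) (∑-bound (f ∘ suc) (f≤c ∘ suc))

∑<⇒∃< : ∀ {m} c (f : Fin m → ℕ) → ∑[ i < m ] f i < m * c → ∃[ i ] f i < c
∑<⇒∃< {zero}  c f ()
∑<⇒∃< {suc m} c f ∑f<m*c with f zero <? c
... | yes f₀<c = zero , f₀<c
-- the head contributes at least c, so the tail stays below m · c
... | no  f₀≮c
  with i , fᵢ₊₁<c ← ∑<⇒∃< c (f ∘ suc) (+-cancelˡ-< c _ _ (≤-<-trans (+-monoˡ-≤ _ (≮⇒≥ f₀≮c)) ∑f<m*c))
  = suc i , fᵢ₊₁<c

𝟙 : {P : Set} → Dec P → ℕ
𝟙 (yes _) = 1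
𝟙 (no _)  = 0

𝟙≡0⇒¬ : {P : Set} (d : Dec P) → 𝟙 d ≡ 0 → ¬ P
𝟙≡0⇒¬ (no ¬p) _ = ¬p

¬⇒𝟙≤0 : {P : Set} (d : Dec P) → ¬ P → 𝟙 d ≤ 0
¬⇒𝟙≤0 (yes p) ¬p = contradiction p ¬p
¬⇒𝟙≤0 (no _)  ¬p = z≤n

∑𝟙-atMostOne : ∀ {m} {P : Fin m → Set} (P? : ∀ i → Dec (P i)) →
               (∀ i j → P i → P j → i ≡ j) → ∑[ i < m ] 𝟙 (P? i) ≤ 1
∑𝟙-atMostOne {zero}  P? unique = z≤n
∑𝟙-atMostOne {suc m} {P} P? unique with P? zero
... | yes p₀ = s≤s (≤-trans (∑-bound (𝟙 ∘ P? ∘ suc) (λ i → ¬⇒𝟙≤0 (P? (suc i)) (others i)))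
                           (≤-reflexive (*-zeroʳ m)))
  where
  others : ∀ i → ¬ P (suc i)
  others i pᵢ with () ← unique zero (suc i) p₀ pᵢ
... | no _ = ∑𝟙-atMostOne (P? ∘ suc) (λ i j pᵢ pⱼ → suc-injective (unique (suc i) (suc j) pᵢ pⱼ))

count-functional : ∀ {m k} {R : Fin m → Fin k → Set} (R? : ∀ a b → Dec (R a b)) →
                   (∀ a b b′ → R a b → R a b′ → b ≡ b′) →
                   ∑[ a < m ] ∑[ b < k ] 𝟙 (R? a b) ≤ m
count-functional {m} {k} R? functional =
  ≤-trans (∑-bound (λ a → ∑[ b < k ] 𝟙 (R? a b)) (λ a → ∑𝟙-atMostOne (R? a) (functional a)))
          (≤-reflexive (*-identityʳ m))

count-cofunctional : ∀ {m k} {R : Fin m → Fin k → Set} (R? : ∀ a b → Dec (R a b)) →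
                     (∀ b a a′ → R a b → R a′ b → a ≡ a′) →
                     ∑[ a < m ] ∑[ b < k ] 𝟙 (R? a b) ≤ k
count-cofunctional R? cofunctional =
  ≤-trans (≤-reflexive (∑-comm (λ a b → 𝟙 (R? a b))))
    (count-functional (λ b a → R? a b) cofunctional)

∑³ : ∀ {m} → (Fin m → Fin m → Fin m → ℕ) → ℕ
∑³ {m} f = ∑[ i < m ] ∑[ j < m ] ∑[ k < m ] f i j k

∑³-distrib-+ : ∀ {m} (f g : Fin m → Fin m → Fin m → ℕ) →
               ∑³ (λ i j k → f i j k + g i j k) ≡ ∑³ f + ∑³ g
∑³-distrib-+ {m} f g = begin
  ∑³ (λ i j k → f i j k + g i j k)
    ≡⟨ sum-cong-≗ (λ i → sum-cong-≗ (λ j → ∑-distrib-+ (f i j) (g i j))) ⟩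
  ∑[ i < m ] ∑[ j < m ] (∑[ k < m ] f i j k + ∑[ k < m ] g i j k)
    ≡⟨ sum-cong-≗ (λ i → ∑-distrib-+ (λ j → sum (f i j)) (λ j → sum (g i j))) ⟩
  ∑[ i < m ] (∑[ j < m ] ∑[ k < m ] f i j k + ∑[ j < m ] ∑[ k < m ] g i j k)
    ≡⟨ ∑-distrib-+ (λ i → ∑[ j < m ] sum (f i j)) (λ i → ∑[ j < m ] sum (g i j)) ⟩
  ∑³ f + ∑³ g ∎
  where open ≡-Reasoning

-- In each case the free coordinate is moved outermost.
∑³-ij : ∀ {m c} (g : Fin m → Fin m → ℕ) → ∑[ a < m ] ∑[ b < m ] g a b ≤ c →
        ∑³ (λ i j k → g i j) ≤ m * c
∑³-ij {m} g ∑²g≤c =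
  ≤-trans (≤-reflexive free-k-outermost)
          (∑-bound {m} (λ _ → ∑[ a < m ] ∑[ b < m ] g a b) (λ _ → ∑²g≤c))
  where
  free-k-outermost : ∑³ (λ i j k → g i j) ≡ ∑[ k < m ] ∑[ i < m ] ∑[ j < m ] g i j
  free-k-outermost = begin
    ∑[ i < m ] ∑[ j < m ] ∑[ k < m ] g i j ≡⟨ sum-cong-≗ (λ i → ∑-comm {m} {m} (λ j k → g i j)) ⟩
    ∑[ i < m ] ∑[ k < m ] ∑[ j < m ] g i j ≡⟨ ∑-comm {m} {m} (λ i k → ∑[ j < m ] g i j) ⟩
    ∑[ k < m ] ∑[ i < m ] ∑[ j < m ] g i j ∎
    where open ≡-Reasoning

∑³-ik : ∀ {m c} (g : Fin m → Fin m → ℕ) → ∑[ a < m ] ∑[ b < m ] g a b ≤ c →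
        ∑³ (λ i j k → g i k) ≤ m * c
∑³-ik {m} g ∑²g≤c =
  ≤-trans (≤-reflexive (∑-comm {m} {m} (λ i j → ∑[ k < m ] g i k)))
        (∑-bound {m} (λ _ → ∑[ a < m ] ∑[ b < m ] g a b) (λ _ → ∑²g≤c))

∑³-jk : ∀ {m c} (g : Fin m → Fin m → ℕ) → ∑[ a < m ] ∑[ b < m ] g a b ≤ c →
        ∑³ (λ i j k → g j k) ≤ m * c
∑³-jk {m} g ∑²g≤c = ∑-bound {m} (λ _ → ∑[ a < m ] ∑[ b < m ] g a b) (λ _ → ∑²g≤c)

∑³<⇒∃zero : ∀ {m} (f : Fin m → Fin m → Fin m → ℕ) → ∑³ f < m * (m * m) →
            ∃[ i ] ∃[ j ] ∃[ k ] f i j k ≡ 0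
∑³<⇒∃zero {m} f ∑³f< =
  let i , ∑²fᵢ< = ∑<⇒∃< (m * m) (λ i → ∑[ j < m ] ∑[ k < m ] f i j k) ∑³f<
      j , ∑fᵢⱼ< = ∑<⇒∃< m (λ j → ∑[ k < m ] f i j k) ∑²fᵢ<
      k , fᵢⱼₖ<1 = ∑<⇒∃< 1 (f i j) (subst (∑[ k < m ] f i j k <_) (sym (*-identityʳ m)) ∑fᵢⱼ<)
  in i , j , k , n<1⇒n≡0 fᵢⱼₖ<1

-- The arithmetic behind the counting: 6m² < m³ once m ≥ 7 (matching m
-- against suc makes m * m visibly non-zero, as *-monoˡ-< requires).
six-squares<cube : ∀ {m} → 7 ≤ m → m * (m + m) + m * (m + m) + m * (m + m) < m * (m * m)
six-squares<cube {m@(suc _)} 7≤m = begin-strict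
  m * (m + m) + m * (m + m) + m * (m + m) ≡⟨ six-squares m ⟩
  6 * (m * m)                             <⟨ *-monoˡ-< (m * m) (n<1+n 6) ⟩
  7 * (m * m)                             ≤⟨ *-monoˡ-≤ (m * m) 7≤m ⟩
  m * (m * m)                             ∎
  where
  open ≤-Reasoning
  six-squares : ∀ m → m * (m + m) + m * (m + m) + m * (m + m) ≡ 6 * (m * m)
  six-squares = solve-∀

EachHasPrivatePoint : ∀ {n} → Subset n → Subset n → Subset n → Set
EachHasPrivatePoint A B C =
  Nonempty (A ─ (B ∪ C)) × Nonempty (B ─ (A ∪ C)) × Nonempty (C ─ (A ∪ B))

x∈p─q : ∀ {n} {x : Fin n} (p q : Subset n) → x ∈ₛ p → x ∉ₛ q → x ∈ₛ p ─ q
x∈p─q (inside ∷ p) (outside ∷ q) here      x∉q = here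
x∈p─q (inside ∷ p) (inside  ∷ q) here      x∉q = contradiction here x∉q
x∈p─q (_      ∷ p) (_       ∷ q) (there x∈p) x∉q = there (x∈p─q p q x∈p (x∉q ∘ there))

private-point : ∀ {n} {x : Fin n} (A B C : Subset n) →
                x ∈ₛ A → x ∉ₛ B → x ∉ₛ C → Nonempty (A ─ (B ∪ C))
private-point A B C x∈A x∉B x∉C = _ , x∈p─q A (B ∪ C) x∈A x∉B∪C
  where
  x∉B∪C : _ ∉ₛ B ∪ C
  x∉B∪C x∈B∪C with x∈p∪q⁻ B C x∈B∪C
  ... | inj₁ x∈B = x∉B x∈B
  ... | inj₂ x∈C = x∉C x∈C

record DisjointSystem (n m : ℕ) : Set where
  field
    member   : Fin m → Subset n
    point    : Fin m → Fin n
    point∈   : ∀ i → point i ∈ₛ member i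
    disjoint : ∀ {x} i j → x ∈ₛ member i → x ∈ₛ member j → i ≡ j

open DisjointSystem

conflict : ∀ {n m} (X Y : DisjointSystem n m) → Fin m → Fin m → ℕ
conflict X Y i j = 𝟙 (point X i ∈? member Y j) + 𝟙 (point Y j ∈? member X i)

-- Each representative meets at most one member of the other system.
conflict-count : ∀ {n m} (X Y : DisjointSystem n m) →
                 ∑[ i < m ] ∑[ j < m ] conflict X Y i j ≤ m + m
conflict-count {m = m} X Y = begin
  ∑[ i < m ] ∑[ j < m ] conflict X Y i j
    ≡⟨ sum-cong-≗ (λ i → ∑-distrib-+ (λ j → 𝟙 (point X i ∈? member Y j))
                                      (λ j → 𝟙 (point Y j ∈? member X i))) ⟩
  ∑[ i < m ] (∑[ j < m ] 𝟙 (point X i ∈? member Y j) + ∑[ j < m ] 𝟙 (point Y j ∈? member X i))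
    ≡⟨ ∑-distrib-+ (λ i → ∑[ j < m ] 𝟙 (point X i ∈? member Y j))
                   (λ i → ∑[ j < m ] 𝟙 (point Y j ∈? member X i)) ⟩
  ∑[ i < m ] ∑[ j < m ] 𝟙 (point X i ∈? member Y j) + ∑[ i < m ] ∑[ j < m ] 𝟙 (point Y j ∈? member X i)
    ≤⟨ +-mono-≤ (count-functional (λ i j → point X i ∈? member Y j) (λ i → disjoint Y))
                (count-cofunctional (λ i j → point Y j ∈? member X i) (λ j → disjoint X)) ⟩
  m + m ∎
  where open ≤-Reasoning

conflict-free : ∀ {n m} (X Y : DisjointSystem n m) i j → conflict X Y i j ≡ 0 →
                point X i ∉ₛ member Y j × point Y j ∉ₛ member X i
conflict-free X Y i j none =
  𝟙≡0⇒¬ (point X i ∈? member Y j) (m+n≡0⇒m≡0 _ none) ,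
  𝟙≡0⇒¬ (point Y j ∈? member X i) (m+n≡0⇒n≡0 _ none)

spoilt : ∀ {n m} (X Y Z : DisjointSystem n m) → Fin m → Fin m → Fin m → ℕ
spoilt X Y Z i j k = conflict X Y i j + conflict X Z i k + conflict Y Z j k

-- Each conflicting pair spoils m triples, so fewer than m³ triples are spoilt.
spoilt-count : ∀ {n m} → 7 ≤ m → (X Y Z : DisjointSystem n m) → ∑³ (spoilt X Y Z) < m * (m * m)
spoilt-count {m = m} 7≤m X Y Z = begin-strict
  ∑³ (spoilt X Y Z)
    ≡⟨ ∑³-distrib-+ (λ i j k → XY i j + XZ i k) (λ i j k → YZ j k) ⟩
  ∑³ (λ i j k → XY i j + XZ i k) + ∑³ (λ i j k → YZ j k)
    ≡⟨ cong (_+ ∑³ (λ i j k → YZ j k)) (∑³-distrib-+ (λ i j k → XY i j) (λ i j k → XZ i k)) ⟩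
  ∑³ (λ i j k → XY i j) + ∑³ (λ i j k → XZ i k) + ∑³ (λ i j k → YZ j k)
    ≤⟨ +-mono-≤ (+-mono-≤ (∑³-ij XY (conflict-count X Y)) (∑³-ik XZ (conflict-count X Z)))
                (∑³-jk YZ (conflict-count Y Z)) ⟩
  m * (m + m) + m * (m + m) + m * (m + m)
    <⟨ six-squares<cube 7≤m ⟩
  m * (m * m) ∎
  where
  open ≤-Reasoning
  XY XZ YZ : Fin m → Fin m → ℕ
  XY = conflict X Y
  XZ = conflict X Z
  YZ = conflict Y Z

unspoilt⇒private : ∀ {n m} (X Y Z : DisjointSystem n m) i j k → spoilt X Y Z i j k ≡ 0 →
                   EachHasPrivatePoint (member X i) (member Y j) (member Z k)
unspoilt⇒private X Y Z i j k none =
  private-point (member X i) _ _ (point∈ X i) (proj₁ XY-free) (proj₁ XZ-free) ,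
  private-point (member Y j) _ _ (point∈ Y j) (proj₂ XY-free) (proj₁ YZ-free) ,
  private-point (member Z k) _ _ (point∈ Z k) (proj₂ XZ-free) (proj₂ YZ-free)
  where
  XY+XZ≡0 : conflict X Y i j + conflict X Z i k ≡ 0
  XY+XZ≡0 = m+n≡0⇒m≡0 _ none

  XY-free : point X i ∉ₛ member Y j × point Y j ∉ₛ member X i
  XY-free = conflict-free X Y i j (m+n≡0⇒m≡0 _ XY+XZ≡0)
  XZ-free : point X i ∉ₛ member Z k × point Z k ∉ₛ member X i
  XZ-free = conflict-free X Z i k (m+n≡0⇒n≡0 (conflict X Y i j) XY+XZ≡0)
  YZ-free : point Y j ∉ₛ member Z k × point Z k ∉ₛ member Y j
  YZ-free = conflict-free Y Z j k (m+n≡0⇒n≡0 (conflict X Y i j + conflict X Z i k) none)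

private-triple : ∀ {n m} → 7 ≤ m → (X Y Z : DisjointSystem n m) →
                 ∃[ i ] ∃[ j ] ∃[ k ] EachHasPrivatePoint (member X i) (member Y j) (member Z k)
private-triple 7≤m X Y Z =
  let i , j , k , none = ∑³<⇒∃zero (spoilt X Y Z) (spoilt-count 7≤m X Y Z)
  in  i , j , k , unspoilt⇒private X Y Z i j k none

disjoint-positions : ∀ {n} {F : List (Subset n)} → AllPairs Disjoint F →
                     ∀ {x} (i j : Fin (length F)) → x ∈ₛ lookup F i → x ∈ₛ lookup F j → i ≡ j
disjoint-positions (_ ∷ _) zero zero _ _ = refl
disjoint-positions (F₀#F ∷ _) zero (suc j) x∈F₀ x∈Fⱼ =
  contradiction (_ , x∈p∩q⁺ (x∈F₀ , x∈Fⱼ)) (All.lookup F₀#F (∈-lookup j))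
disjoint-positions (F₀#F ∷ _) (suc i) zero x∈Fᵢ x∈F₀ =
  contradiction (_ , x∈p∩q⁺ (x∈F₀ , x∈Fᵢ)) (All.lookup F₀#F (∈-lookup i))
disjoint-positions (_ ∷ F#F) (suc i) (suc j) x∈Fᵢ x∈Fⱼ =
  cong suc (disjoint-positions F#F i j x∈Fᵢ x∈Fⱼ)

system : ∀ {n m} {F : List (Subset n)} → m ≤ length F →
         All Nonempty F → AllPairs Disjoint F → DisjointSystem n m
system {n} {m} {F} m≤|F| nonempty disj = record
  { member   = lookup F ∘ position
  ; point    = λ i → proj₁ (element i)
  ; point∈   = λ i → proj₂ (element i)
  ; disjoint = λ i j x∈Fᵢ x∈Fⱼ →
      inject≤-injective m≤|F| m≤|F| i j (disjoint-positions disj _ _ x∈Fᵢ x∈Fⱼ)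
  }
  where
  position : Fin m → Fin (length F)
  position i = inject≤ i m≤|F|
  element : ∀ i → Nonempty (lookup F (position i))
  element i = All.lookup nonempty (∈-lookup (position i))

system-members : ∀ {n m} {F : List (Subset n)} (m≤|F| : m ≤ length F)
                 (nonempty : All Nonempty F) (disj : AllPairs Disjoint F) →
                 ∀ i → member (system m≤|F| nonempty disj) i ∈ F
system-members m≤|F| _ _ i = ∈-lookup (inject≤ i m≤|F|)

lemma9 : (n : ℕ) (𝒜 ℬ 𝒞 : List (Subset n)) →
    SevenDisjointFamily 𝒜 → SevenDisjointFamily ℬ → SevenDisjointFamily 𝒞 →
    Σ (Subset n) λ A → Σ (Subset n) λ B → Σ (Subset n) λ C →
    (A ∈ 𝒜) × (B ∈ ℬ) × (C ∈ 𝒞) ×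
    Nonempty (A ─ (B ∪ C)) × Nonempty (B ─ (A ∪ C)) × Nonempty (C ─ (A ∪ B))
lemma9 n 𝒜 ℬ 𝒞 (7≤|𝒜| , ne𝒜 , disj𝒜) (7≤|ℬ| , neℬ , disjℬ) (7≤|𝒞| , ne𝒞 , disj𝒞) =
  let i , j , k , private-points = private-triple ≤-refl (system 7≤|𝒜| ne𝒜 disj𝒜)
                                                        (system 7≤|ℬ| neℬ disjℬ)
                                                        (system 7≤|𝒞| ne𝒞 disj𝒞)
  in  _ , _ , _ ,
      system-members 7≤|𝒜| ne𝒜 disj𝒜 i ,
      system-members 7≤|ℬ| neℬ disjℬ j ,
      system-members 7≤|𝒞| ne𝒞 disj𝒞 k ,
      private-points
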